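{- Let $q$ be a prime power, $F_q$ the field with $q$ elements, $V=F_q^n$, and $1<k<n-1$. Let $S$ be a $(k-1)$-dimensional linear code in $V$ whose generator matrix $M$ has exactly one zero column, and let $S'\subseteq F_q^{n-1}$ be the code generated by the $(k-1)\times(n-1)$ matrix $M'$ obtained from $M$ by deleting the zero column. If $S'$ is a $(k-1)$-dimensional projective code, then $[S\rangle^{\Pi}_{k}$ is a star of $\Pi[n,k]_q$.
   Context: A linear code $[n,k]_q$ is a $k$-dimensional subspace of $V=F_q^n$; a generator matrix is a matrix whose rows form a basis of it. A code is projective if the columns of a generator matrix are non-zero and pairwise non-proportional. $\Pi(n,k)_q$ denotes the set of all $k$-dimensional projective codes in $V$, and $\Pi[n,k]_q$ is the simple graph with vertex set $\Pi(n,k)_q$ in which two distinct codes are adjacent iff their intersection is $(k-1)$-dimensional. A clique is a set of pairwise adjacent vertices; it is maximal if not properly contained in another clique. $[S\rangle^{\Pi}_{k}$ denotes the set of all elements of $\Pi(n,k)_q$ containing $S$; it is called a star of $\Pi[n,k]_q$ if it is a maximal clique of $\Pi[n,k]_q$. -}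

module Defs where

open import Level using (Level; _⊔_)
open import Algebra.Bundles using (CommutativeRing)
open import Data.Nat as ℕ using (ℕ; _^_; _∸_)
open import Data.Nat.Primality using (Prime)
open import Data.Fin as Fin using (Fin)
open import Data.Product using (Σ; ∃; ∃₂; _×_; _,_; proj₁; proj₂)
open import Relation.Nullary using (¬_)
open import Relation.Binary.PropositionalEquality as ≡ using (_≡_; _≢_)
open import Function.Bundles using (Inverse)

IsPrimePower : ℕ → Set
IsPrimePower q = ∃₂ λ p e → Prime p × q ≡ p ^ ℕ.suc e

record FiniteField (c ℓ : Level) (q : ℕ) : Set (Level.suc (c ⊔ ℓ)) where
  field
    commRing : CommutativeRing c ℓ
  open CommutativeRing commRing public
  field
    0≉1     : ¬ (0# ≈ 1#)
    inverse : ∀ x → ¬ (x ≈ 0#) → ∃ λ y → x * y ≈ 1#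
    card    : Inverse (≡.setoid (Fin q)) setoid

module LinearCodes {c ℓ : Level} {q : ℕ} (F : FiniteField c ℓ q) where
  open FiniteField F

  Vect : ℕ → Set c
  Vect n = Fin n → Carrier

  Matrix : ℕ → ℕ → Set c
  Matrix k n = Fin k → Fin n → Carrier

  _≈ᵛ_ : ∀ {n} → Vect n → Vect n → Set ℓ
  u ≈ᵛ v = ∀ i → u i ≈ v i

  0ᵛ : ∀ {n} → Vect n
  0ᵛ _ = 0#

  _·ᵛ_ : ∀ {n} → Carrier → Vect n → Vect n
  (a ·ᵛ v) i = a * v i

  ∑ : ∀ {k} → (Fin k → Carrier) → Carrier
  ∑ {ℕ.zero}  f = 0#
  ∑ {ℕ.suc k} f = f Fin.zero + ∑ (λ i → f (Fin.suc i))

  lincomb : ∀ {k n} → Vect k → Matrix k n → Vect n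
  lincomb cs G j = ∑ (λ i → cs i * G i j)

  LinIndep : ∀ {k n} → Matrix k n → Set (c ⊔ ℓ)
  LinIndep G = ∀ cs → lincomb cs G ≈ᵛ 0ᵛ → ∀ i → cs i ≈ 0#

  InSpan : ∀ {k n} → Matrix k n → Vect n → Set (c ⊔ ℓ)
  InSpan G v = ∃ λ cs → v ≈ᵛ lincomb cs G

  column : ∀ {k n} → Matrix k n → Fin n → Vect k
  column G j i = G i j

  record Code (n k : ℕ) : Set (c ⊔ ℓ) where
    constructor code
    field
      gen   : Matrix k n
      indep : LinIndep gen

  _∈C_ : ∀ {n k} → Vect n → Code n k → Set (c ⊔ ℓ)
  v ∈C C = InSpan (Code.gen C) v

  _≐_ : ∀ {n k} → Code n k → Code n k → Set (c ⊔ ℓ)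
  C ≐ D = (∀ v → v ∈C C → v ∈C D) × (∀ v → v ∈C D → v ∈C C)

  Projective : ∀ {k n} → Matrix k n → Set (c ⊔ ℓ)
  Projective G =
    (∀ j → ¬ (column G j ≈ᵛ 0ᵛ)) ×
    (∀ j j' → j ≢ j' → ¬ (∃ λ a → column G j ≈ᵛ (a ·ᵛ column G j')))

  ProjCode : ℕ → ℕ → Set (c ⊔ ℓ)
  ProjCode n k = Σ (Code n k) (λ C → Projective (Code.gen C))

  IntersectionDim : ∀ {n k} → Code n k → Code n k → ℕ → Set (c ⊔ ℓ)
  IntersectionDim {n} C D m =
    ∃ λ (B : Matrix m n) → LinIndep B ×
      (∀ i → B i ∈C C × B i ∈C D) ×
      (∀ v → v ∈C C → v ∈C D → InSpan B v)

  Adjacent : ∀ {n k} → ProjCode n k → ProjCode n k → Set (c ⊔ ℓ)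
  Adjacent {n} {k} X Y =
    ¬ (proj₁ X ≐ proj₁ Y) × IntersectionDim (proj₁ X) (proj₁ Y) (k ∸ 1)

  VSet : ℕ → ℕ → Set (Level.suc (c ⊔ ℓ))
  VSet n k = ProjCode n k → Set (c ⊔ ℓ)

  IsClique : ∀ {n k} → VSet n k → Set (c ⊔ ℓ)
  IsClique K = ∀ X Y → K X → K Y → ¬ (proj₁ X ≐ proj₁ Y) → Adjacent X Y

  IsMaximalClique : ∀ {n k} → VSet n k → Set (Level.suc (c ⊔ ℓ))
  IsMaximalClique {n} {k} K =
    IsClique K ×
    ((K' : VSet n k) → IsClique K' → (∀ X → K X → K' X) →
       ∀ X → K' X → ∃ λ Y → K Y × (proj₁ X ≐ proj₁ Y))

  -- [S⟩^Π_k where S is the row space of G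
  StarSet : ∀ {m n} (k : ℕ) → Matrix m n → VSet n k
  StarSet k G X = ∀ i → G i ∈C proj₁ X

  IsStar : ∀ {m} (n k : ℕ) → Matrix m n → Set (Level.suc (c ⊔ ℓ))
  IsStar n k G = IsMaximalClique (StarSet {n = n} k G)

module Submission where

-- A k-dimensional code containing S is S + ⟨v⟩; since S vanishes on coordinate j and S′ is
-- projective, it is projective exactly when v_j ≠ 0. Two such codes meet in S, so the star is a
-- clique. A code X ⊉ S adjacent to all of them meets S + ⟨v⟩ outside S, hence contains a vector
-- of every coset v + S with v_j ≠ 0. As k < n − 1, the space S + ⟨e_j⟩ has codimension at
-- least 2, so X ∩ (S + ⟨e_j⟩) together with vectors of two cosets e_j + e_t + S chosen
-- independent modulo S + ⟨e_j⟩ gives k + 1 independent vectors in X, contradicting the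
-- Steinitz exchange lemma.

open import Defs
open import Level using (Level)
open import Data.Nat using (ℕ; suc; zero; _<_; _≤_; _∸_; z≤n; s≤s)
open import Data.Nat.Properties using (m≤n⇒m≤1+n; <⇒≱; n≮n; <-trans; n<1+n)
open import Data.Fin using (Fin; zero; suc; punchIn; punchOut; _≟_)
open import Data.Fin.Properties
  using (any?; all?; ¬∀⟶∃¬; inj⇒≟; punchInᵢ≢i; punchIn-punchOut; punchOut-injective)
open import Data.Vec.Functional using (_∷_; head; tail; insertAt; removeAt)
open import Data.Vec.Functional.Properties using (insertAt-lookup; insertAt-punchIn)
open import Data.Product using (∃; _×_; _,_; proj₁; proj₂)
open import Data.Empty using (⊥-elim)
open import Function.Base using (_∘_)
open import Function.Bundles using (Inverse; _⇔_; mk⇔)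
open import Function.Properties.Inverse using (Inverse⇒Injection)
open import Function.Construct.Symmetry using () renaming (inverse to flipInverse)
open import Relation.Nullary using (¬_; Dec; yes; no; ¬?)
open import Relation.Nullary.Decidable using (map′; map; decidable-stable)
open import Relation.Binary.Definitions using (Decidable)
open import Relation.Binary.PropositionalEquality as ≡ using (_≡_; _≢_)

module _ {c ℓ : Level} {q : ℕ} (F : FiniteField c ℓ q) where
  open FiniteField F hiding (zero)
  open LinearCodes F
  open import Algebra.Properties.Ring ring
    using ( -‿distribˡ-*; -1*x≈-x; +-inverseˡ-unique; -‿anti-homo-+; -‿involutive
          ; xyx⁻¹≈y; //-rightDividesˡ; x≈z//y)
  open import Algebra.Properties.Semiring.Sum semiring
    using (sum; sum-cong-≋; sum-replicate-zero; sum-remove; *-distribˡ-sum; *-distribʳ-sum)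
    renaming (∑-distrib-+ to sum-distrib-+)
  open import Relation.Binary.Reasoning.Setoid setoid

  _≈?_ : Decidable _≈_
  _≈?_ = inj⇒≟ (Inverse⇒Injection (flipInverse card))

  any-scalar? : ∀ {p} (P : Carrier → Set p) → (∀ {x y} → x ≈ y → P x → P y) →
                (∀ x → Dec (P x)) → Dec (∃ P)
  any-scalar? P resp P? =
    map′ (λ (i , Pi) → to i , Pi) (λ (x , Px) → from x , resp (sym (strictlyInverseˡ x)) Px)
         (any? (P? ∘ to))
    where open Inverse card using (to; from; strictlyInverseˡ)

  *-cancel-inverse : ∀ {a b} → a * b ≈ 1# → ∀ x → x ≈ b * (a * x)
  *-cancel-inverse {a} {b} ab≈1 x = begin
    x            ≈⟨ *-identityˡ x ⟨
    1# * x       ≈⟨ *-cong (trans (sym ab≈1) (*-comm a b)) refl ⟩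
    (b * a) * x  ≈⟨ *-assoc b a x ⟩
    b * (a * x)  ∎

  x-[x-y]≈y : ∀ x y → x - (x - y) ≈ y
  x-[x-y]≈y x y = begin
    x + - (x + - y)    ≈⟨ +-cong refl (-‿anti-homo-+ x (- y)) ⟩
    x + (- - y + - x)  ≈⟨ +-cong refl (+-cong (-‿involutive y) refl) ⟩
    x + (y + - x)      ≈⟨ +-assoc x y (- x) ⟨
    x + y + - x        ≈⟨ xyx⁻¹≈y x y ⟩
    y                  ∎

  ∑≡sum : ∀ {k} (f : Fin k → Carrier) → ∑ f ≡ sum f
  ∑≡sum {zero}  f = ≡.refl
  ∑≡sum {suc k} f = ≡.cong (f zero +_) (∑≡sum (tail f))

  ∑-cong : ∀ {k} {f g : Fin k → Carrier} → (∀ i → f i ≈ g i) → ∑ f ≈ ∑ g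
  ∑-cong {f = f} {g} f≈g = ≡.subst₂ _≈_ (≡.sym (∑≡sum f)) (≡.sym (∑≡sum g)) (sum-cong-≋ f≈g)

  ∑-zero : ∀ {k} {f : Fin k → Carrier} → (∀ i → f i ≈ 0#) → ∑ f ≈ 0#
  ∑-zero {k} f≈0 =
    trans (∑-cong f≈0) (≡.subst (_≈ 0#) (≡.sym (∑≡sum {k} (λ _ → 0#))) (sum-replicate-zero k))

  ∑-distrib-+ : ∀ {k} (f g : Fin k → Carrier) → ∑ (λ i → f i + g i) ≈ ∑ f + ∑ g
  ∑-distrib-+ f g rewrite ∑≡sum (λ i → f i + g i) | ∑≡sum f | ∑≡sum g = sum-distrib-+ f g

  *-distribˡ-∑ : ∀ {k} x (f : Fin k → Carrier) → x * ∑ f ≈ ∑ (λ i → x * f i)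
  *-distribˡ-∑ x f rewrite ∑≡sum f | ∑≡sum (λ i → x * f i) = *-distribˡ-sum x f

  *-distribʳ-∑ : ∀ {k} x (f : Fin k → Carrier) → ∑ f * x ≈ ∑ (λ i → f i * x)
  *-distribʳ-∑ x f rewrite ∑≡sum f | ∑≡sum (λ i → f i * x) = *-distribʳ-sum x f

  ∑-remove : ∀ {k} (f : Fin (suc k) → Carrier) i → ∑ f ≈ f i + ∑ (removeAt f i)
  ∑-remove f i rewrite ∑≡sum f | ∑≡sum (removeAt f i) = sum-remove f

  ∑-single : ∀ {k} (f : Fin (suc k) → Carrier) i → (∀ t → f (punchIn i t) ≈ 0#) → ∑ f ≈ f i
  ∑-single f i rest≈0 = begin
    ∑ f                      ≈⟨ ∑-remove f i ⟩
    f i + ∑ (removeAt f i)   ≈⟨ +-cong refl (∑-zero rest≈0) ⟩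
    f i + 0#                 ≈⟨ +-identityʳ (f i) ⟩
    f i                      ∎

  infixl 25 _+ᵛ_ _-ᵛ_

  _+ᵛ_ : ∀ {n} → Vect n → Vect n → Vect n
  (u +ᵛ v) i = u i + v i

  _-ᵛ_ : ∀ {n} → Vect n → Vect n → Vect n
  (u -ᵛ v) i = u i - v i

  unit : ∀ {n} → Fin n → Vect n
  unit t s with t ≟ s
  ... | yes _ = 1#
  ... | no  _ = 0#

  unit-diag : ∀ {n} (t : Fin n) → unit t t ≈ 1#
  unit-diag t with t ≟ t
  ... | yes _  = refl
  ... | no t≢t = ⊥-elim (t≢t ≡.refl)

  unit-off : ∀ {n} {t s : Fin n} → t ≢ s → unit t s ≈ 0#
  unit-off {t = t} {s} t≢s with t ≟ s
  ... | yes t≡s = ⊥-elim (t≢s t≡s)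
  ... | no  _   = refl

  lincomb-unitˡ : ∀ {k n} (A : Matrix (suc k) n) i → lincomb (unit i) A ≈ᵛ A i
  lincomb-unitˡ A i j = begin
    lincomb (unit i) A j  ≈⟨ ∑-single (λ t → unit i t * A t j) i rest≈0 ⟩
    unit i i * A i j      ≈⟨ *-cong (unit-diag i) refl ⟩
    1# * A i j            ≈⟨ *-identityˡ (A i j) ⟩
    A i j                 ∎
    where
    rest≈0 : ∀ t → unit i (punchIn i t) * A (punchIn i t) j ≈ 0#
    rest≈0 t = trans (*-cong (unit-off (punchInᵢ≢i i t ∘ ≡.sym)) refl) (zeroˡ _)

  lincomb-unitʳ : ∀ {n} (cs : Vect (suc n)) → lincomb cs unit ≈ᵛ cs
  lincomb-unitʳ cs s = begin
    lincomb cs unit s  ≈⟨ ∑-single (λ t → cs t * unit t s) s rest≈0 ⟩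
    cs s * unit s s    ≈⟨ *-cong refl (unit-diag s) ⟩
    cs s * 1#          ≈⟨ *-identityʳ (cs s) ⟩
    cs s               ∎
    where
    rest≈0 : ∀ t → cs (punchIn s t) * unit (punchIn s t) s ≈ 0#
    rest≈0 t = trans (*-cong refl (unit-off (punchInᵢ≢i s t))) (zeroʳ _)

  lincomb-+ᵛ : ∀ {k n} (cs ds : Vect k) (A : Matrix k n) →
               lincomb (cs +ᵛ ds) A ≈ᵛ lincomb cs A +ᵛ lincomb ds A
  lincomb-+ᵛ cs ds A j = begin
    ∑ (λ i → (cs i + ds i) * A i j)        ≈⟨ ∑-cong (λ i → distribʳ (A i j) (cs i) (ds i)) ⟩
    ∑ (λ i → cs i * A i j + ds i * A i j)  ≈⟨ ∑-distrib-+ (λ i → cs i * A i j) (λ i → ds i * A i j) ⟩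
    lincomb cs A j + lincomb ds A j        ∎

  lincomb-·ᵛ : ∀ {k n} a (cs : Vect k) (A : Matrix k n) → lincomb (a ·ᵛ cs) A ≈ᵛ (a ·ᵛ lincomb cs A)
  lincomb-·ᵛ a cs A j = begin
    ∑ (λ i → (a * cs i) * A i j)  ≈⟨ ∑-cong (λ i → *-assoc a (cs i) (A i j)) ⟩
    ∑ (λ i → a * (cs i * A i j))  ≈⟨ *-distribˡ-∑ a (λ i → cs i * A i j) ⟨
    a * lincomb cs A j            ∎

  lincomb-head≈0 : ∀ {k n} {cs : Vect (suc k)} (A : Matrix (suc k) n) →
                   head cs ≈ 0# → lincomb cs A ≈ᵛ lincomb (tail cs) (tail A)
  lincomb-head≈0 {cs = cs} A c≈0 j = begin
    head cs * A zero j + lincomb (tail cs) (tail A) j  ≈⟨ +-cong (trans (*-cong c≈0 refl) (zeroˡ _)) refl ⟩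
    0# + lincomb (tail cs) (tail A) j                  ≈⟨ +-identityˡ _ ⟩
    lincomb (tail cs) (tail A) j                       ∎

  lincomb-insertAt : ∀ {k n} (cs : Vect k) (A : Matrix (suc k) n) p x →
                     lincomb (insertAt cs p x) A ≈ᵛ (x ·ᵛ A p) +ᵛ lincomb cs (removeAt A p)
  lincomb-insertAt cs A p x j = begin
    lincomb (insertAt cs p x) A j
      ≈⟨ ∑-remove (λ i → insertAt cs p x i * A i j) p ⟩
    insertAt cs p x p * A p j + ∑ (λ t → insertAt cs p x (punchIn p t) * A (punchIn p t) j)
      ≈⟨ +-cong (*-cong (reflexive (insertAt-lookup cs p x)) refl)
                (∑-cong (λ t → *-cong (reflexive (insertAt-punchIn cs p x t)) refl)) ⟩
    x * A p j + lincomb cs (removeAt A p) j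
      ∎

  lincomb-sweep : ∀ {k n} (cs ν : Vect k) (B : Matrix k n) u →
                  lincomb cs (λ t → B t +ᵛ (ν t ·ᵛ u))
                    ≈ᵛ lincomb cs B +ᵛ (∑ (λ t → cs t * ν t) ·ᵛ u)
  lincomb-sweep cs ν B u j = begin
    ∑ (λ t → cs t * (B t j + ν t * u j))
      ≈⟨ ∑-cong (λ t → trans (distribˡ (cs t) _ _) (+-cong refl (sym (*-assoc _ _ _)))) ⟩
    ∑ (λ t → cs t * B t j + cs t * ν t * u j)
      ≈⟨ ∑-distrib-+ (λ t → cs t * B t j) (λ t → cs t * ν t * u j) ⟩
    lincomb cs B j + ∑ (λ t → cs t * ν t * u j)
      ≈⟨ +-cong refl (*-distribʳ-∑ (u j) (λ t → cs t * ν t)) ⟨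
    lincomb cs B j + ∑ (λ t → cs t * ν t) * u j
      ∎

  module _ {k n : ℕ} {A : Matrix k n} where

    span-cong : ∀ {u v} → u ≈ᵛ v → InSpan A u → InSpan A v
    span-cong u≈v (cs , u≈) = cs , λ j → trans (sym (u≈v j)) (u≈ j)

    span-0 : InSpan A 0ᵛ
    span-0 = 0ᵛ , λ j → sym (∑-zero (λ i → zeroˡ (A i j)))

    span-+ : ∀ {u v} → InSpan A u → InSpan A v → InSpan A (u +ᵛ v)
    span-+ (cs , u≈) (ds , v≈) =
      cs +ᵛ ds , λ j → trans (+-cong (u≈ j) (v≈ j)) (sym (lincomb-+ᵛ cs ds A j))

    span-· : ∀ {u} a → InSpan A u → InSpan A (a ·ᵛ u)
    span-· a (cs , u≈) = a ·ᵛ cs , λ j → trans (*-cong refl (u≈ j)) (sym (lincomb-·ᵛ a cs A j))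

    span-sub : ∀ {u v} → InSpan A u → InSpan A v → InSpan A (u -ᵛ v)
    span-sub {v = v} u∈ v∈ =
      span-cong (λ j → +-cong refl (-1*x≈-x (v j))) (span-+ u∈ (span-· (- 1#) v∈))

    span-+-cancelˡ : ∀ {u w} → InSpan A u → InSpan A (u +ᵛ w) → InSpan A w
    span-+-cancelˡ {u} {w} u∈ u+w∈ = span-cong (λ j → xyx⁻¹≈y (u j) (w j)) (span-sub u+w∈ u∈)

    span-translate : ∀ {x v} → InSpan A (x -ᵛ v) → InSpan A x → InSpan A v
    span-translate {x} {v} x-v∈ x∈ = span-cong (λ j → x-[x-y]≈y (x j) (v j)) (span-sub x∈ x-v∈)

    span-translate⁻ : ∀ {x v} → InSpan A (x -ᵛ v) → InSpan A v → InSpan A x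
    span-translate⁻ {x} {v} x-v∈ v∈ =
      span-cong (λ j → //-rightDividesˡ (v j) (x j)) (span-+ x-v∈ v∈)

    coset-∉span : ∀ {x u w} → InSpan A (x -ᵛ (u +ᵛ w)) → InSpan A u → ¬ InSpan A w → ¬ InSpan A x
    coset-∉span x-v∈ u∈ w∉ x∈ = w∉ (span-+-cancelˡ u∈ (span-translate x-v∈ x∈))

  span-row : ∀ {k n} (A : Matrix k n) i → InSpan A (A i)
  span-row {suc k} A i = unit i , λ j → sym (lincomb-unitˡ A i j)

  span-lincomb : ∀ {k m n} {A : Matrix k n} {B : Matrix m n} →
                 (∀ i → InSpan B (A i)) → ∀ cs → InSpan B (lincomb cs A)
  span-lincomb {zero}  A⊆B cs = span-0
  span-lincomb {suc k} A⊆B cs =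
    span-+ (span-· (head cs) (A⊆B zero)) (span-lincomb (A⊆B ∘ suc) (tail cs))

  span-trans : ∀ {k m n} {A : Matrix k n} {B : Matrix m n} →
               (∀ i → InSpan B (A i)) → ∀ {v} → InSpan A v → InSpan B v
  span-trans A⊆B (cs , v≈) = span-cong (λ j → sym (v≈ j)) (span-lincomb A⊆B cs)

  span-∷ : ∀ {k n} {E : Matrix k n} {w v} → InSpan E v → InSpan (w ∷ E) v
  span-∷ {E = E} {w} = span-trans {B = w ∷ E} (λ i → span-row (w ∷ E) (suc i))

  ∷-⊆span : ∀ {k m n} {A : Matrix k n} {G : Matrix m n} {v} →
            InSpan G v → (∀ i → InSpan G (A i)) → ∀ i → InSpan G ((v ∷ A) i)
  ∷-⊆span v∈G A⊆G zero    = v∈G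
  ∷-⊆span v∈G A⊆G (suc i) = A⊆G i

  unit∉span⇒≢ : ∀ {k n} {A : Matrix k n} {t s} → ¬ InSpan A (unit t) → InSpan A (unit s) → t ≢ s
  unit∉span⇒≢ unit-t∉A unit-s∈A ≡.refl = unit-t∉A unit-s∈A

  span-tail : ∀ {k n} {A : Matrix (suc k) n} {v} ((cs , _) : InSpan A v) → head cs ≈ 0# →
              InSpan (tail A) v
  span-tail {A = A} (cs , v≈) c≈0 = tail cs , λ j → trans (v≈ j) (lincomb-head≈0 {cs = cs} A c≈0 j)

  span-tail-pivot : ∀ {k n} {A : Matrix (suc k) n} {v} ((cs , _) : InSpan A v) → ∀ {y} →
                    head cs * y ≈ 1# → InSpan (tail A) ((y ·ᵛ v) -ᵛ head A)
  span-tail-pivot {A = A} {v} (cs , v≈) {y} cy≈1 = span-cong yL≈ (span-· y (tail cs , λ j → refl))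
    where
    yL≈ : (y ·ᵛ lincomb (tail cs) (tail A)) ≈ᵛ ((y ·ᵛ v) -ᵛ head A)
    yL≈ j = sym (begin
      y * v j - a                      ≈⟨ +-cong (*-cong refl (v≈ j)) refl ⟩
      y * (head cs * a + L) - a        ≈⟨ +-cong (distribˡ y _ L) refl ⟩
      y * (head cs * a) + y * L - a    ≈⟨ +-cong (+-cong (sym (*-cancel-inverse cy≈1 a)) refl) refl ⟩
      a + y * L - a                    ≈⟨ xyx⁻¹≈y a (y * L) ⟩
      y * L                            ∎)
      where
      a = A zero j
      L = lincomb (tail cs) (tail A) j

  span⇔∃span-tail : ∀ {k n} (A : Matrix (suc k) n) v →
                    (∃ λ x → InSpan (tail A) (v -ᵛ (x ·ᵛ head A))) ⇔ InSpan A v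
  span⇔∃span-tail A v = mk⇔ to from
    where
    to : ∃ (λ x → InSpan (tail A) (v -ᵛ (x ·ᵛ head A))) → InSpan A v
    to (x , cs , v-xa≈) = x ∷ cs , λ j → begin
      v j                                   ≈⟨ //-rightDividesˡ (x * A zero j) (v j) ⟨
      v j - x * A zero j + x * A zero j     ≈⟨ +-comm _ _ ⟩
      x * A zero j + (v j - x * A zero j)   ≈⟨ +-cong refl (v-xa≈ j) ⟩
      x * A zero j + lincomb cs (tail A) j  ∎
    from : InSpan A v → ∃ (λ x → InSpan (tail A) (v -ᵛ (x ·ᵛ head A)))
    from (cs , v≈) = head cs , tail cs , λ j → sym (x≈z//y _ _ _ (trans (+-comm _ _) (sym (v≈ j))))

  span? : ∀ {k n} (A : Matrix k n) v → Dec (InSpan A v)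
  span? {zero}  A v = map′ (λ v≈0 → (λ ()) , v≈0) proj₂ (all? (λ j → v j ≈? 0#))
  span? {suc k} A v = map (span⇔∃span-tail A v)
    (any-scalar? _ (λ x≈y → span-cong (λ j → +-cong refl (-‿cong (*-cong x≈y refl))))
                   (λ x → span? (tail A) (v -ᵛ (x ·ᵛ head A))))

  -- Linear independence and the Steinitz exchange lemma

  LinIndep-∷ : ∀ {k n} {A : Matrix k n} {v} → LinIndep A → ¬ InSpan A v → LinIndep (v ∷ A)
  LinIndep-∷ {A = A} {v} indA v∉A cs cs·vA≈0 with head cs ≈? 0#
  ... | yes c≈0 = λ where
    zero    → c≈0
    (suc i) → indA (tail cs) (λ j → trans (sym (lincomb-head≈0 {cs = cs} (v ∷ A) c≈0 j)) (cs·vA≈0 j)) i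
  ... | no c≉0 = ⊥-elim (v∉A (span-cong v≈ (span-· y (span-· (- 1#) (tail cs , λ j → refl)))))
    where
    y = proj₁ (inverse (head cs) c≉0)
    v≈ : (y ·ᵛ ((- 1#) ·ᵛ lincomb (tail cs) A)) ≈ᵛ v
    v≈ j = sym (begin
      v j                                 ≈⟨ *-cancel-inverse (proj₂ (inverse (head cs) c≉0)) (v j) ⟩
      y * (head cs * v j)                 ≈⟨ *-cong refl (+-inverseˡ-unique _ _ (cs·vA≈0 j)) ⟩
      y * - lincomb (tail cs) A j         ≈⟨ *-cong refl (-1*x≈-x _) ⟨
      y * (- 1# * lincomb (tail cs) A j)  ∎)

  LinIndep-∷-coset : ∀ {b e s n} {B : Matrix b n} {E : Matrix e n} {S : Matrix s n} {x u w} →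
                     (∀ i → InSpan E (S i)) → (∀ i → InSpan E (B i)) → LinIndep B →
                     InSpan E u → ¬ InSpan E w → InSpan S (x -ᵛ (u +ᵛ w)) →
                     LinIndep (x ∷ B) × (∀ i → InSpan (w ∷ E) ((x ∷ B) i))
  LinIndep-∷-coset {B = B} {E} {S} {x} {u} {w} S⊆E B⊆E indB u∈E w∉E x-v∈S =
    LinIndep-∷ {A = B} indB x∉B , ∷-⊆span {G = w ∷ E} x∈wE (λ i → span-∷ {E = E} (B⊆E i))
    where
    x-v∈E : InSpan E (x -ᵛ (u +ᵛ w))
    x-v∈E = span-trans {B = E} S⊆E x-v∈S
    x∉B : ¬ InSpan B x
    x∉B x∈B = coset-∉span {A = E} x-v∈E u∈E w∉E (span-trans {B = E} B⊆E x∈B)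
    x∈wE : InSpan (w ∷ E) x
    x∈wE = span-translate⁻ {A = w ∷ E} (span-∷ {E = E} x-v∈E)
                           (span-+ {A = w ∷ E} (span-∷ {E = E} u∈E) (span-row (w ∷ E) zero))

  LinIndep-unit : ∀ {n} → LinIndep {n} unit
  LinIndep-unit {suc n} cs cs·I≈0 s = trans (sym (lincomb-unitʳ cs s)) (cs·I≈0 s)

  LinIndep⇒row≉0 : ∀ {k n} {A : Matrix k n} → LinIndep A → ∀ i → ¬ (A i ≈ᵛ 0ᵛ)
  LinIndep⇒row≉0 {suc k} {A = A} indA i Ai≈0 =
    0≉1 (trans (sym (indA (unit i) (λ j → trans (lincomb-unitˡ A i j) (Ai≈0 j)) i)) (unit-diag i))

  LinIndep-sweep : ∀ {k n} {A : Matrix (suc k) n} → LinIndep A → ∀ p (ν : Vect k) →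
                   LinIndep (λ t → removeAt A p t +ᵛ (ν t ·ᵛ A p))
  LinIndep-sweep {A = A} indA p ν cs cs·A′≈0 t = begin
    cs t               ≡⟨ insertAt-punchIn cs p S t ⟨
    cs′ (punchIn p t)  ≈⟨ indA cs′ cs′·A≈0 (punchIn p t) ⟩
    0#                 ∎
    where
    S = ∑ (λ t → cs t * ν t)
    cs′ = insertAt cs p S
    cs′·A≈0 : lincomb cs′ A ≈ᵛ 0ᵛ
    cs′·A≈0 j = begin
      lincomb cs′ A j                                      ≈⟨ lincomb-insertAt cs A p S j ⟩
      S * A p j + lincomb cs (removeAt A p) j              ≈⟨ +-comm _ _ ⟩
      lincomb cs (removeAt A p) j + S * A p j              ≈⟨ lincomb-sweep cs ν (removeAt A p) (A p) j ⟨
      lincomb cs (λ t → removeAt A p t +ᵛ (ν t ·ᵛ A p)) j  ≈⟨ cs·A′≈0 j ⟩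
      0#                                                   ∎

  -- One step of Gaussian elimination: ν is chosen so that adding ν t times the pivot row p
  -- cancels the coefficient of every other row on the first generator of W.
  eliminate-pivot : ∀ {a w n} (A : Matrix (suc a) n) (W : Matrix (suc w) n) → LinIndep A →
                    (A⊆W : ∀ i → InSpan W (A i)) → ∀ p → ¬ head (proj₁ (A⊆W p)) ≈ 0# →
                    ∃ λ (A′ : Matrix a n) → LinIndep A′ × (∀ t → InSpan (tail W) (A′ t))
  eliminate-pivot A W indA A⊆W p c≉0 = A′ , LinIndep-sweep {A = A} indA p ν , A′⊆W′
    where
    cs : Fin _ → Vect _
    cs i = proj₁ (A⊆W i)
    lead : Fin _ → Carrier
    lead i = head (cs i)
    y = proj₁ (inverse (lead p) c≉0)
    ν : Vect _
    ν t = - (lead (punchIn p t) * y)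
    A′ : Matrix _ _
    A′ t = removeAt A p t +ᵛ (ν t ·ᵛ A p)
    ds : Fin _ → Vect _
    ds t = cs (punchIn p t) +ᵛ (ν t ·ᵛ cs p)
    ds-head≈0 : ∀ t → head (ds t) ≈ 0#
    ds-head≈0 t = begin
      l + - (l * y) * lead p  ≈⟨ +-cong refl (-‿distribˡ-* _ _) ⟨
      l + - (l * y * lead p)  ≈⟨ +-cong refl (-‿cong (trans (*-assoc _ _ _) (*-cong refl y·lead≈1))) ⟩
      l + - (l * 1#)          ≈⟨ +-cong refl (-‿cong (*-identityʳ l)) ⟩
      l + - l                 ≈⟨ -‿inverseʳ l ⟩
      0#                      ∎
      where
      l = lead (punchIn p t)
      y·lead≈1 = trans (*-comm _ _) (proj₂ (inverse (lead p) c≉0))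
    A′⊆W′ : ∀ t → InSpan (tail W) (A′ t)
    A′⊆W′ t = tail (ds t) , λ j → begin
      A (punchIn p t) j + ν t * A p j
        ≈⟨ +-cong (proj₂ (A⊆W (punchIn p t)) j) (*-cong refl (proj₂ (A⊆W p) j)) ⟩
      lincomb (cs (punchIn p t)) W j + ν t * lincomb (cs p) W j
        ≈⟨ +-cong refl (lincomb-·ᵛ (ν t) (cs p) W j) ⟨
      lincomb (cs (punchIn p t)) W j + lincomb (ν t ·ᵛ cs p) W j
        ≈⟨ lincomb-+ᵛ (cs (punchIn p t)) (ν t ·ᵛ cs p) W j ⟨
      lincomb (ds t) W j
        ≈⟨ lincomb-head≈0 {cs = ds t} W (ds-head≈0 t) j ⟩
      lincomb (tail (ds t)) (tail W) j
        ∎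

  steinitz : ∀ {a w n} (A : Matrix a n) (W : Matrix w n) → LinIndep A → (∀ i → InSpan W (A i)) → a ≤ w
  steinitz {zero}          A W indA A⊆W = z≤n
  steinitz {suc a} {zero}  A W indA A⊆W = ⊥-elim (LinIndep⇒row≉0 {A = A} indA zero (proj₂ (A⊆W zero)))
  steinitz {suc a} {suc w} A W indA A⊆W with any? (λ i → ¬? (head (proj₁ (A⊆W i)) ≈? 0#))
  ... | yes (p , c≉0) with eliminate-pivot A W indA A⊆W p c≉0
  ...   | A′ , indA′ , A′⊆W′ = s≤s (steinitz A′ (tail W) indA′ A′⊆W′)
  steinitz {suc a} {suc w} A W indA A⊆W | no ∄pivot =
    m≤n⇒m≤1+n (steinitz A (tail W) indA (λ i → span-tail {A = W} (A⊆W i) (lead≈0 i)))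
    where
    lead≈0 : ∀ i → head (proj₁ (A⊆W i)) ≈ 0#
    lead≈0 i = decidable-stable (_ ≈? 0#) (λ c≉0 → ∄pivot (i , c≉0))

  LinIndep-spans : ∀ {k n} {A G : Matrix k n} → LinIndep A → (∀ i → InSpan G (A i)) →
                   ∀ {v} → InSpan G v → InSpan A v
  LinIndep-spans {k} {A = A} {G} indA A⊆G {v} v∈G with span? A v
  ... | yes v∈A = v∈A
  ... | no  v∉A = ⊥-elim (n≮n k (steinitz (v ∷ A) G (LinIndep-∷ indA v∉A) (∷-⊆span v∈G A⊆G)))

  ∃unit∉span : ∀ {a n} (A : Matrix a n) → a < n → ∃ λ t → ¬ InSpan A (unit t)
  ∃unit∉span {a} {n} A a<n with all? (λ t → span? A (unit t))
  ... | yes I⊆A = ⊥-elim (<⇒≱ a<n (steinitz unit A LinIndep-unit I⊆A))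
  ... | no  I⊈A = ¬∀⟶∃¬ n _ (λ t → span? A (unit t)) I⊈A

  ≐-of-common-basis : ∀ {n k} (X Y : Code n k) (B : Matrix k n) → LinIndep B →
                      (∀ i → B i ∈C X) → (∀ i → B i ∈C Y) → X ≐ Y
  ≐-of-common-basis X Y B indB B⊆X B⊆Y =
    (λ v v∈X → span-trans B⊆Y (LinIndep-spans indB B⊆X v∈X)) ,
    (λ v v∈Y → span-trans B⊆X (LinIndep-spans indB B⊆Y v∈Y))

  -- The star of S

  module _ {m r : ℕ} (M : Matrix r (suc m)) (indM : LinIndep M) (j : Fin (suc m))
           (Mj≈0 : column M j ≈ᵛ 0ᵛ) (M≉0 : ∀ t → t ≢ j → ¬ (column M t ≈ᵛ 0ᵛ))
           (projM′ : Projective (λ i t → M i (punchIn j t))) where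

    ∉span-M : ∀ {v} → ¬ v j ≈ 0# → ¬ InSpan M v
    ∉span-M vj≉0 (cs , v≈) =
      vj≉0 (trans (v≈ j) (∑-zero (λ i → trans (*-cong refl (Mj≈0 i)) (zeroʳ (cs i)))))

    M-columns-nonproportional : ∀ {t t′} → t ≢ j → t′ ≢ j → t ≢ t′ →
                                ¬ ∃ λ a → ∀ i → M i t ≈ a * M i t′
    M-columns-nonproportional t≢j t′≢j t≢t′ (a , Mt≈aMt′) =
      proj₂ projM′ (punchOut j≢t) (punchOut j≢t′) (t≢t′ ∘ punchOut-injective j≢t j≢t′) (a , λ i →
        ≡.subst₂ (λ u u′ → M i u ≈ a * M i u′)
                 (≡.sym (punchIn-punchOut j≢t)) (≡.sym (punchIn-punchOut j≢t′)) (Mt≈aMt′ i))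
      where
      j≢t = t≢j ∘ ≡.sym
      j≢t′ = t′≢j ∘ ≡.sym

    projective-∷ : ∀ {v} → ¬ v j ≈ 0# → Projective (v ∷ M)
    projective-∷ {v} vj≉0 = nonzero , nonproportional
      where
      nonzero : ∀ t → ¬ (column (v ∷ M) t ≈ᵛ 0ᵛ)
      nonzero t col≈0 with t ≟ j
      ... | yes ≡.refl = vj≉0 (col≈0 zero)
      ... | no  t≢j    = M≉0 t t≢j (col≈0 ∘ suc)
      nonproportional : ∀ t t′ → t ≢ t′ → ¬ ∃ λ a → column (v ∷ M) t ≈ᵛ (a ·ᵛ column (v ∷ M) t′)
      nonproportional t t′ t≢t′ (a , col≈) with t ≟ j | t′ ≟ j
      ... | yes ≡.refl | yes ≡.refl = t≢t′ ≡.refl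
      ... | no  t≢j    | no  t′≢j   = M-columns-nonproportional t≢j t′≢j t≢t′ (a , col≈ ∘ suc)
      ... | no  t≢j    | yes ≡.refl =
        M≉0 t t≢j (λ i → trans (col≈ (suc i)) (trans (*-cong refl (Mj≈0 i)) (zeroʳ a)))
      ... | yes ≡.refl | no  t′≢j with a ≈? 0#
      ...   | yes a≈0 = vj≉0 (trans (col≈ zero) (trans (*-cong a≈0 refl) (zeroˡ _)))
      ...   | no  a≉0 = M≉0 t′ t′≢j (λ i → begin
        M i t′            ≈⟨ *-cancel-inverse (proj₂ (inverse a a≉0)) (M i t′) ⟩
        b * (a * M i t′)  ≈⟨ *-cong refl (col≈ (suc i)) ⟨
        b * M i j         ≈⟨ *-cong refl (Mj≈0 i) ⟩
        b * 0#            ≈⟨ zeroʳ b ⟩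
        0#                ∎)
        where b = proj₁ (inverse a a≉0)

    extension : (v : Vect (suc m)) → ¬ v j ≈ 0# → ProjCode (suc m) (suc r)
    extension v vj≉0 = code (v ∷ M) (LinIndep-∷ indM (∉span-M vj≉0)) , projective-∷ vj≉0

    extension∈star : ∀ {v} (vj≉0 : ¬ v j ≈ 0#) → StarSet (suc r) M (extension v vj≉0)
    extension∈star {v} _ i = span-row (v ∷ M) (suc i)

    star-isClique : IsClique (StarSet {n = suc m} (suc r) M)
    star-isClique (X , _) (Y , _) S⊆X S⊆Y X≠Y = X≠Y , M , indM , (λ i → S⊆X i , S⊆Y i) , X∩Y⊆S
      where
      X∩Y⊆S : ∀ v → v ∈C X → v ∈C Y → InSpan M v
      X∩Y⊆S v v∈X v∈Y with span? M v
      ... | yes v∈S = v∈S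
      ... | no  v∉S = ⊥-elim (X≠Y (≐-of-common-basis X Y (v ∷ M) (LinIndep-∷ indM v∉S)
                                     (∷-⊆span {G = Code.gen X} v∈X S⊆X)
                                     (∷-⊆span {G = Code.gen Y} v∈Y S⊆Y)))

    -- X ∩ (S + ⟨v⟩) has dimension k − 1 = dim S, so it is not contained in S (else it would be
    -- S ⊆ X): some basis vector has a nonzero coefficient on v.
    meets-coset : (X : Code (suc m) (suc r)) → ∀ {i₀} → ¬ M i₀ ∈C X → ∀ {v} (vj≉0 : ¬ v j ≈ 0#) →
                  IntersectionDim X (proj₁ (extension v vj≉0)) r → ∃ λ x → x ∈C X × InSpan M (x -ᵛ v)
    meets-coset X {i₀} Mi₀∉X {v} vj≉0 (B , indB , B⊆X∩Y , _)
      with any? (λ i → ¬? (head (proj₁ (proj₂ (B⊆X∩Y i))) ≈? 0#))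
    ... | yes (p , c≉0) = let y , cy≈1 = inverse _ c≉0 in
      y ·ᵛ B p , span-· {A = Code.gen X} y (proj₁ (B⊆X∩Y p)) ,
      span-tail-pivot {A = v ∷ M} (proj₂ (B⊆X∩Y p)) cy≈1
    ... | no ∄pivot =
      ⊥-elim (Mi₀∉X (span-trans {B = Code.gen X} (proj₁ ∘ B⊆X∩Y)
                                (LinIndep-spans indB B⊆S (span-row M i₀))))
      where
      B⊆S : ∀ i → InSpan M (B i)
      B⊆S i = span-tail {A = v ∷ M} (proj₂ (B⊆X∩Y i))
                        (decidable-stable (_ ≈? 0#) (λ c≉0 → ∄pivot (i , c≉0)))

    unit-j+unit≉0 : ∀ {t} → t ≢ j → ¬ (unit j +ᵛ unit t) j ≈ 0#
    unit-j+unit≉0 {t} t≢j sum≈0 = 0≉1 (begin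
      0#                   ≈⟨ sum≈0 ⟨
      unit j j + unit t j  ≈⟨ +-cong (unit-diag j) (unit-off t≢j) ⟩
      1# + 0#              ≈⟨ +-identityʳ 1# ⟩
      1#                   ∎)

    ⊉S⇒¬adjacent-to-star : suc (suc r) < suc m → (X : Code (suc m) (suc r)) → ∀ {i₀} → ¬ M i₀ ∈C X →
                            ¬ (∀ v (vj≉0 : ¬ v j ≈ 0#) → IntersectionDim X (proj₁ (extension v vj≉0)) r)
    ⊉S⇒¬adjacent-to-star r+2<n X Mi₀∉X adjacent =
      let E₂ = unit j ∷ M
          B , indB , B⊆X∩E₂ , _ = adjacent (unit j) (λ ujj≈0 → 0≉1 (trans (sym ujj≈0) (unit-diag j)))
          t₂ , unit-t₂∉E₂ = ∃unit∉span E₂ (<-trans (n<1+n _) r+2<n)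
          E₃ = unit t₂ ∷ E₂
          t₃ , unit-t₃∉E₃ = ∃unit∉span E₃ r+2<n
          x₂ , x₂∈X , x₂∈v₂+S = coset (unit∉span⇒≢ {A = E₂} {t₂} unit-t₂∉E₂ (span-row E₂ zero))
          x₃ , x₃∈X , x₃∈v₃+S = coset (unit∉span⇒≢ {A = E₃} {t₃} unit-t₃∉E₃ (span-row E₃ (suc zero)))
          indx₂B , x₂B⊆E₃ =
            LinIndep-∷-coset {B = B} {E = E₂} {S = M} (λ i → span-row E₂ (suc i))
              (proj₂ ∘ B⊆X∩E₂) indB (span-row E₂ zero) unit-t₂∉E₂ x₂∈v₂+S
          indx₃x₂B , _ =
            LinIndep-∷-coset {B = x₂ ∷ B} {E = E₃} {S = M} (λ i → span-row E₃ (suc (suc i)))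
              x₂B⊆E₃ indx₂B (span-row E₃ (suc zero)) unit-t₃∉E₃ x₃∈v₃+S
      in n≮n (suc r) (steinitz (x₃ ∷ x₂ ∷ B) (Code.gen X) indx₃x₂B
                        (∷-⊆span {G = Code.gen X} x₃∈X
                          (∷-⊆span {G = Code.gen X} x₂∈X (proj₁ ∘ B⊆X∩E₂))))
      where
      coset : ∀ {t} → t ≢ j → ∃ λ x → x ∈C X × InSpan M (x -ᵛ (unit j +ᵛ unit t))
      coset t≢j = meets-coset X Mi₀∉X (unit-j+unit≉0 t≢j) (adjacent _ (unit-j+unit≉0 t≢j))

    clique⊇star⇒⊇S : suc (suc r) < suc m → (K′ : VSet (suc m) (suc r)) → IsClique K′ →
                     (∀ Y → StarSet (suc r) M Y → K′ Y) → ∀ X → K′ X → StarSet (suc r) M X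
    clique⊇star⇒⊇S r+2<n K′ K′-clique star⊆K′ (X , projX) X∈K′
      with all? (λ i → span? (Code.gen X) (M i))
    ... | yes S⊆X = S⊆X
    ... | no  S⊈X with ¬∀⟶∃¬ _ _ (λ i → span? (Code.gen X) (M i)) S⊈X
    ...   | i₀ , Mi₀∉X = ⊥-elim (⊉S⇒¬adjacent-to-star r+2<n X Mi₀∉X λ v vj≉0 →
      proj₂ (K′-clique (X , projX) (extension v vj≉0) X∈K′ (star⊆K′ _ (extension∈star vj≉0))
                       (λ X≐Y → Mi₀∉X (proj₂ X≐Y (M i₀) (extension∈star vj≉0 i₀)))))

    star-isMaximalClique : suc (suc r) < suc m → IsMaximalClique (StarSet {n = suc m} (suc r) M)
    star-isMaximalClique r+2<n = star-isClique , λ K′ K′-clique star⊆K′ X X∈K′ →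
      X , clique⊇star⇒⊇S r+2<n K′ K′-clique star⊆K′ X X∈K′ , (λ _ v∈X → v∈X) , (λ _ v∈X → v∈X)

theorem2 : {c ℓ : Level} (q : ℕ) → IsPrimePower q → (F : FiniteField c ℓ q) →
    let open LinearCodes F in
    (m k : ℕ) → 1 < k → k < m →
    (M : Matrix (k ∸ 1) (suc m)) → LinIndep M →
    (j : Fin (suc m)) → column M j ≈ᵛ 0ᵛ →
    (∀ j' → j' ≢ j → ¬ (column M j' ≈ᵛ 0ᵛ)) →
    LinIndep (λ i t → M i (punchIn j t)) →
    Projective (λ i t → M i (punchIn j t)) →
    IsStar (suc m) k M
theorem2 q _ F m zero    ()
theorem2 q _ F m (suc r) _ k<m M indM j Mj≈0 M≉0 _ projM′ =
  star-isMaximalClique F M indM j Mj≈0 M≉0 projM′ (s≤s k<m)
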